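{- Let $$W=\mathbb{Z}_{\le 3}\cup\bigcup_{k=1}^\infty\left[\frac{(k-1)(k+2)}{2}+2^{k+1},\ \frac{(k-1)(k+2)}{2}+2^{k+1}+k\right]$$ $(=\mathbb{Z}_{\le3}\cup\{4,5\}\cup\{10,11,12\}\cup\{21,\dots,24\}\cup\{41,\dots,45\}\cup\cdots)$. Then: $W$ admits a minimal complement in $\mathbb{Z}$; for any asymptotic complement $C$ of $W$ and any $a,b,c\in C$ with $a<b<c$, the set $C\setminus\{b\}$ is also an asymptotic complement to $W$; and $W$ admits no minimal asymptotic complement in $\mathbb{Z}$.
   Context: $[x,y]$ denotes the set of integers $n$ with $x\le n\le y$, and $\mathbb{Z}_{\le 3}=\{n\in\mathbb{Z}: n\le 3\}$. For nonempty $A,B\subseteq\mathbb{Z}$, $A+B=\{a+b: a\in A,b\in B\}$. Given nonempty $W,C\subseteq \mathbb{Z}$: $C$ is a complement to $W$ if $W+C=\mathbb{Z}$; a minimal complement if it is a complement but $C\setminus\{c\}$ is not for every $c\in C$. $C$ is an asymptotic complement to $W$ if $\mathbb{Z}\setminus(W+C)$ is finite; a minimal asymptotic complement if it is an asymptotic complement but $C\setminus\{c\}$ is not for every $c\in C$. -}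

module Defs where

open import Level using (0ℓ)
open import Data.Nat as ℕ using (ℕ; suc; ⌊_/2⌋)
open import Data.Integer using (ℤ; +_; _+_; _≤_; _<_)
open import Data.Product using (Σ; ∃; _×_; _,_)
open import Data.Sum using (_⊎_)
open import Data.List using (List)
open import Data.List.Membership.Propositional using (_∈_)
open import Relation.Nullary using (¬_)
open import Relation.Binary.PropositionalEquality using (_≡_; _≢_)
open import Relation.Unary using (Pred)

SetZ : Set₁
SetZ = Pred ℤ 0ℓ

-- Left endpoint of the k-th block: (k-1)(k+2)/2 + 2^(k+1)  (for k ≥ 1; (k-1)(k+2) is even)
blockStart : ℕ → ℕ
blockStart k = ⌊ (k ℕ.∸ 1) ℕ.* (k ℕ.+ 2) /2⌋ ℕ.+ 2 ℕ.^ (k ℕ.+ 1)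

W : SetZ
W n = (n ≤ + 3) ⊎ (Σ ℕ λ k → (1 ℕ.≤ k) × (+ blockStart k ≤ n) × (n ≤ + (blockStart k ℕ.+ k)))

_⊕_ : SetZ → SetZ → SetZ
(A ⊕ B) n = Σ ℤ λ a → Σ ℤ λ b → A a × B b × (a + b ≡ n)

_without_ : SetZ → ℤ → SetZ
(C without c) x = C x × (x ≢ c)

FiniteZ : SetZ → Set
FiniteZ S = Σ (List ℤ) λ xs → ∀ n → S n → n ∈ xs

IsComplement : SetZ → SetZ → Set
IsComplement W C = (Σ ℤ C) × (∀ n → (W ⊕ C) n)

IsMinimalComplement : SetZ → SetZ → Set
IsMinimalComplement W C = IsComplement W C × (∀ c → C c → ¬ IsComplement W (C without c))

IsAsymptoticComplement : SetZ → SetZ → Set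
IsAsymptoticComplement W C = (Σ ℤ C) × FiniteZ (λ n → ¬ (W ⊕ C) n)

IsMinimalAsymptoticComplement : SetZ → SetZ → Set
IsMinimalAsymptoticComplement W C =
  IsAsymptoticComplement W C × (∀ c → C c → ¬ IsAsymptoticComplement W (C without c))

module Submission where

-- The blocks grow linearly
-- while the gaps between them grow exponentially: block m+2 starts 2^(m+2) + 1 places after
-- block m+1 ends.  All three claims come from playing these two growth rates off each other.
--
-- (1) Minimal complement.  With δ(y) = s_y − y, the point y + δ(y) = s_y lies in W, while
--     a + δ(y) lies in the gap below block y for every a < y.  Choosing greedily, in
--     increasing order, the points y ≥ 4 outside W not yet covered by an earlier choice
--     (module Greedy, stated for arbitrary decidable data) gives C₀ = {0} ∪ {−δ(y)}, in
--     which 0 is the only element covering 3 and −δ(y) the only element covering y.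
-- (2) Removing a middle element.  For a < b < c in C, every w ∈ W outside the first
--     (c−b)+(b−a) blocks has w − (c−b) ∈ W or w + (b−a) ∈ W (escape), so w + b stays
--     covered by c or a; the finitely many exceptions keep the complement asymptotic.
-- (3) No minimal asymptotic complement.  By (2) such a complement has no three distinct
--     elements, but for any two integers c, c′ the sets W + c and W + c′ miss a common
--     point beyond any bound (farMiss), so no set of at most two elements is one.

open import Defs

module BlockGeometry where

  open import Data.Nat using (ℕ; zero; suc; ⌊_/2⌋; _+_; _*_; _^_; _≤_; _<_; _≤′_; ≤′-refl; ≤′-step; z≤n; s≤s; _≤?_)
  open import Data.Nat.Properties
  open import Data.Nat.Tactic.RingSolver using (solve-∀)
  open import Data.Integer using (+_; +≤+)
  open import Data.Sum using (inj₁; inj₂)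
  open import Data.Product using (_,_)
  open import Relation.Nullary using (¬_; Dec; yes; no; contradiction)
  open import Relation.Nullary.Decidable using (_×-dec_)
  open import Relation.Binary.PropositionalEquality

  blockEnd : ℕ → ℕ
  blockEnd k = blockStart k + k

  ⌊y+[y+x]/2⌋ : ∀ y x → ⌊ y + (y + x) /2⌋ ≡ y + ⌊ x /2⌋
  ⌊y+[y+x]/2⌋ zero    x = refl
  ⌊y+[y+x]/2⌋ (suc y) x rewrite +-suc y (y + x) = cong suc (⌊y+[y+x]/2⌋ y x)

  blockStart-next : ∀ m → blockStart (2 + m) ≡ suc (blockEnd (suc m)) + 2 ^ (suc m + 1)
  blockStart-next m = begin
    ⌊ suc m * (a + 2) /2⌋ + 2 * p   ≡⟨ cong (λ z → ⌊ z /2⌋ + 2 * p) (product m) ⟩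
    ⌊ a + (a + q) /2⌋ + 2 * p       ≡⟨ cong (_+ 2 * p) (⌊y+[y+x]/2⌋ a q) ⟩
    a + ⌊ q /2⌋ + 2 * p             ≡⟨ regroup m ⌊ q /2⌋ p ⟩
    suc (⌊ q /2⌋ + p + suc m) + p   ∎
    where
    open ≡-Reasoning
    a q p : ℕ
    a = suc (suc m)
    q = m * (suc m + 2)
    p = 2 ^ (suc m + 1)
    product : ∀ m → suc m * (suc (suc m) + 2) ≡ suc (suc m) + (suc (suc m) + m * (suc m + 2))
    product = solve-∀
    regroup : ∀ m h p → suc (suc m) + h + 2 * p ≡ suc (h + p + suc m) + p
    regroup = solve-∀

  n<2^n : ∀ n → n < 2 ^ n
  n<2^n zero    = s≤s z≤n
  n<2^n (suc n) = +-mono-≤ (≤-trans (s≤s z≤n) (n<2^n n)) (≤-trans (n<2^n n) (m≤m+n _ 0))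

  k<blockStart : ∀ k → k < blockStart k
  k<blockStart k = ≤-trans (n<2^n k) (≤-trans (^-monoʳ-≤ 2 (m≤m+n k 1)) (m≤n+m _ _))

  stepMono : (f : ℕ → ℕ) → (∀ n → f n ≤ f (suc n)) → ∀ {m n} → m ≤ n → f m ≤ f n
  stepMono f step m≤n = go (≤⇒≤′ m≤n)
    where
    go : ∀ {m n} → m ≤′ n → f m ≤ f n
    go ≤′-refl         = ≤-refl
    go (≤′-step m≤′n) = ≤-trans (go m≤′n) (step _)

  blockEnd<next : ∀ m → blockEnd (suc m) < blockStart (2 + m)
  blockEnd<next m rewrite blockStart-next m = s≤s (m≤m+n _ _)

  blockStart-mono : ∀ {j k} → 1 ≤ j → j ≤ k → blockStart j ≤ blockStart k
  blockStart-mono {suc j} {suc k} _ (s≤s j≤k) =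
    stepMono (λ n → blockStart (suc n)) (λ n → ≤-trans (m≤m+n _ (suc n)) (<⇒≤ (blockEnd<next n))) j≤k

  blockEnd-mono : ∀ {j k} → 1 ≤ j → j ≤ k → blockEnd j ≤ blockEnd k
  blockEnd-mono {suc j} {suc k} _ (s≤s j≤k) =
    stepMono (λ n → blockEnd (suc n)) (λ n → ≤-trans (<⇒≤ (blockEnd<next n)) (m≤m+n _ (2 + n))) j≤k

  ¬W-between : ∀ m x → blockEnd (suc m) < x → x < blockStart (2 + m) → ¬ W (+ x)
  ¬W-between m x end<x x<start (inj₁ (+≤+ x≤3)) =
    contradiction (≤-trans (s≤s (blockEnd-mono {1} {suc m} (s≤s z≤n) (s≤s z≤n))) (≤-trans end<x x≤3))
      λ { (s≤s (s≤s (s≤s ()))) }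
  ¬W-between m x end<x x<start (inj₂ (k , 1≤k , +≤+ start≤x , +≤+ x≤end)) with k ≤? suc m
  ... | yes k≤m = <-irrefl refl (≤-trans end<x (≤-trans x≤end (blockEnd-mono 1≤k k≤m)))
  ... | no k≰m  = <-irrefl refl (≤-trans x<start (≤-trans (blockStart-mono (s≤s z≤n) (≰⇒> k≰m)) start≤x))

  ¬W-belowBlock : ∀ m x t → x + t ≡ blockStart (2 + m) → 1 ≤ t → t ≤ 2 ^ (suc m + 1) → ¬ W (+ x)
  ¬W-belowBlock m x t x+t≡start 1≤t t≤2^ = ¬W-between m x end<x x<start
    where
    end<x : blockEnd (suc m) < x
    end<x = +-cancelʳ-≤ (2 ^ (suc m + 1)) _ _
      (subst (_≤ x + 2 ^ (suc m + 1)) (trans x+t≡start (blockStart-next m)) (+-monoʳ-≤ x t≤2^))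
    x<start : x < blockStart (2 + m)
    x<start = subst (x <_) x+t≡start (m<m+n x 1≤t)

  -- Membership in W is decidable: only blocks k < x can contain x.
  W? : ∀ x → Dec (W (+ x))
  W? x with x ≤? 3
  ... | yes x≤3 = yes (inj₁ (+≤+ x≤3))
  ... | no x≰3 with anyUpTo? (λ k → 1 ≤? k ×-dec blockStart k ≤? x ×-dec x ≤? blockEnd k) (suc x)
  ...   | yes (k , _ , 1≤k , start≤x , x≤end) = yes (inj₂ (k , 1≤k , +≤+ start≤x , +≤+ x≤end))
  ...   | no noBlock = no λ
    { (inj₁ (+≤+ x≤3)) → x≰3 x≤3
    ; (inj₂ (k , 1≤k , +≤+ start≤x , +≤+ x≤end)) →
        noBlock (k , s≤s (<⇒≤ (<-≤-trans (k<blockStart k) start≤x)) , 1≤k , start≤x , x≤end) }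

-- Given a decidable set P of points to be covered and a decidable
-- relation Hit n y ("the choice y covers n"), choose y ∈ P whenever no earlier choice
-- covers it.
module Greedy where

  open import Data.Nat using (ℕ; zero; suc; _<_; s≤s)
  open import Data.Nat.Properties using (m≤n⇒m<n∨m≡n)
  open import Data.List using (List; []; _∷_)
  open import Data.List.Membership.Propositional using (_∈_; find)
  open import Data.List.Relation.Unary.Any using (here; there)
  open import Data.List.Relation.Unary.All as All using (All; all?)
  open import Data.List.Relation.Unary.All.Properties using (¬All⇒Any¬)
  open import Data.Product using (Σ; _×_; _,_)
  open import Data.Sum using (inj₁; inj₂)
  open import Relation.Nullary using (¬_; Dec; yes; no; contradiction)
  open import Relation.Nullary.Decidable using (_×-dec_; ¬?; decidable-stable)
  open import Relation.Unary using (Decidable)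
  open import Relation.Binary.PropositionalEquality using (refl)

  module Select {P : ℕ → Set} (P? : Decidable P)
                {Hit : ℕ → ℕ → Set} (Hit? : ∀ n y → Dec (Hit n y)) where

    Fresh : ℕ → List ℕ → Set
    Fresh n ys = P n × All (λ y → ¬ Hit n y) ys

    fresh? : ∀ n ys → Dec (Fresh n ys)
    fresh? n ys = P? n ×-dec all? (λ y → ¬? (Hit? n y)) ys

    chosenBelow : ℕ → List ℕ
    chosenBelow zero = []
    chosenBelow (suc n) with fresh? n (chosenBelow n)
    ... | yes _ = n ∷ chosenBelow n
    ... | no _  = chosenBelow n

    Chosen : ℕ → Set
    Chosen y = Fresh y (chosenBelow y)

    chosenBelow-sound : ∀ n {y} → y ∈ chosenBelow n → Chosen y
    chosenBelow-sound (suc n) y∈ with fresh? n (chosenBelow n) | y∈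
    ... | yes fresh | here refl = fresh
    ... | yes _     | there y∈′ = chosenBelow-sound n y∈′
    ... | no _      | y∈′       = chosenBelow-sound n y∈′

    chosenBelow-complete : ∀ n {y} → Chosen y → y < n → y ∈ chosenBelow n
    chosenBelow-complete (suc n) chosen (s≤s y≤n) with fresh? n (chosenBelow n) | m≤n⇒m<n∨m≡n y≤n
    ... | yes _      | inj₂ refl = here refl
    ... | yes _      | inj₁ y<n  = there (chosenBelow-complete n chosen y<n)
    ... | no unfresh | inj₂ refl = contradiction chosen unfresh
    ... | no _       | inj₁ y<n  = chosenBelow-complete n chosen y<n

    chosen-covers : (∀ n → P n → Hit n n) → ∀ n → P n → Σ ℕ λ y → Chosen y × Hit n y
    chosen-covers hitsSelf n Pn with fresh? n (chosenBelow n)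
    ... | yes fresh = n , fresh , hitsSelf n Pn
    ... | no unfresh with find (¬All⇒Any¬ (λ y → ¬? (Hit? n y)) (chosenBelow n) (λ all → unfresh (Pn , all)))
    ...   | y , y∈ , ¬¬hit = y , chosenBelow-sound n y∈ , decidable-stable (Hit? n y) ¬¬hit

    earlier-misses : ∀ {y y′} → Chosen y → Chosen y′ → y′ < y → ¬ Hit y y′
    earlier-misses (_ , missesEarlier) chosen′ y′<y =
      All.lookup missesEarlier (chosenBelow-complete _ chosen′ y′<y)

open BlockGeometry
open Greedy

open import Data.Nat as ℕ using (ℕ; suc; z≤n; s≤s)
import Data.Nat.Properties as ℕP
import Data.Nat.Tactic.RingSolver as ℕSolver
open import Data.Integer using (ℤ; +_; -[1+_]; _+_; _-_; -_; ∣_∣; _≤_; _<_; +≤+; +<+; -≤+)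
import Data.Integer.Properties as ℤP
open import Data.Integer.Tactic.RingSolver using (solve-∀)
open import Algebra.Properties.AbelianGroup ℤP.+-0-abelianGroup using (∙-cancelˡ)
open import Data.List using (List; _++_; map; upTo)
open import Data.List.Membership.Propositional using (_∈_)
open import Data.List.Membership.Propositional.Properties using (∈-upTo⁺; ∈-map⁺; ∈-++⁺ˡ; ∈-++⁺ʳ)
open import Data.List.Membership.DecPropositional ℤP._≟_ using (_∈?_)
open import Data.List.Relation.Unary.All as All using ()
open import Data.List.Extrema ℤP.≤-totalOrder using (max; xs≤max)
open import Data.Empty using (⊥; ⊥-elim)
open import Data.Product using (Σ; _×_; _,_)
open import Data.Sum using (_⊎_; inj₁; inj₂; [_,_])
open import Relation.Nullary using (¬_; yes; no; contradiction)
open import Relation.Nullary.Decidable using (_×-dec_; ¬?; decidable-stable)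
open import Relation.Unary using (Decidable)
open import Relation.Binary.Definitions using (tri<; tri≈; tri>)
open import Relation.Binary.PropositionalEquality hiding ([_])

-- Part (1): a minimal complement.

shift : ℕ → ℕ
shift y = blockStart y ℕ.∸ y

shift-misses-below : ∀ y a → 2 ℕ.≤ y → a ℕ.< y → ¬ W (+ (a ℕ.+ shift y))
shift-misses-below y@(suc (suc m)) a (s≤s (s≤s z≤n)) a<y =
  ¬W-belowBlock m (a ℕ.+ shift y) (y ℕ.∸ a) reachesStart (ℕP.m<n⇒0<n∸m a<y) short
  where
  open ≡-Reasoning
  reachesStart : a ℕ.+ shift y ℕ.+ (y ℕ.∸ a) ≡ blockStart y
  reachesStart = begin
    a ℕ.+ shift y ℕ.+ (y ℕ.∸ a)   ≡⟨ cong (ℕ._+ (y ℕ.∸ a)) (ℕP.+-comm a (shift y)) ⟩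
    shift y ℕ.+ a ℕ.+ (y ℕ.∸ a)   ≡⟨ ℕP.+-assoc (shift y) a (y ℕ.∸ a) ⟩
    shift y ℕ.+ (a ℕ.+ (y ℕ.∸ a)) ≡⟨ cong (shift y ℕ.+_) (ℕP.m+[n∸m]≡n (ℕP.<⇒≤ a<y)) ⟩
    shift y ℕ.+ y                 ≡⟨ ℕP.m∸n+n≡m (ℕP.<⇒≤ (k<blockStart y)) ⟩
    blockStart y                  ∎
  short : y ℕ.∸ a ℕ.≤ 2 ℕ.^ (suc m ℕ.+ 1)
  short = ℕP.≤-trans (ℕP.m∸n≤m y a) (ℕP.≤-trans (s≤s (ℕP.m≤m+n (suc m) 1)) (n<2^n (suc m ℕ.+ 1)))

-- The points that the element 0 leaves uncovered (those ≤ 3 and those in W are covered by 0).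
Uncovered : ℕ → Set
Uncovered n = 4 ℕ.≤ n × ¬ W (+ n)

-- The element −shift y covers n.
Hits : ℕ → ℕ → Set
Hits n y = W (+ (n ℕ.+ shift y))

hits-self : ∀ n → Uncovered n → Hits n n
hits-self n (4≤n , _) = subst (λ z → W (+ z)) (sym (ℕP.m+[n∸m]≡n (ℕP.<⇒≤ (k<blockStart n)))) startInW
  where
  startInW : W (+ blockStart n)
  startInW = inj₂ (n , ℕP.≤-trans (s≤s z≤n) 4≤n , ℤP.≤-refl , +≤+ (ℕP.m≤m+n _ n))

uncovered? : Decidable Uncovered
uncovered? n = 4 ℕ.≤? n ×-dec ¬? (W? n)

open Select uncovered? {Hits} (λ n y → W? (n ℕ.+ shift y))

C₀ : SetZ
C₀ c = (c ≡ + 0) ⊎ Σ ℕ λ y → Chosen y × (c ≡ - + shift y)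

unshift : ∀ w (n d : ℕ) → w + - + d ≡ + n → w ≡ + (n ℕ.+ d)
unshift w n d eq = trans (addBack w (+ d)) (cong (_+ + d) eq)
  where
  addBack : ∀ w d → w ≡ (w + - d) + d
  addBack = solve-∀

C₀-complement : ∀ n → (W ⊕ C₀) n
C₀-complement n with n ℤP.≤? + 3
... | yes n≤3 = n , + 0 , inj₁ n≤3 , inj₁ refl , ℤP.+-identityʳ n
C₀-complement -[1+ _ ] | no n≰3 = contradiction -≤+ n≰3
C₀-complement (+ m)    | no m≰3 with W? m
... | yes Wm = + m , + 0 , Wm , inj₁ refl , ℤP.+-identityʳ (+ m)
... | no ¬Wm with chosen-covers hits-self m (ℕP.≰⇒> (λ m≤3 → m≰3 (+≤+ m≤3)) , ¬Wm)
...   | y , chosen , hit =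
  + (m ℕ.+ shift y) , - + shift y , hit , inj₂ (y , chosen , refl) , shiftBack (+ m) (+ shift y)
  where
  shiftBack : ∀ x d → (x + d) + - d ≡ x
  shiftBack = solve-∀

-- Without 0 the point 3 is uncovered; without −shift y the point y is uncovered.
C₀-minimal : ∀ c → C₀ c → ¬ IsComplement W (C₀ without c)
C₀-minimal c (inj₁ refl) (_ , complement) with complement (+ 3)
... | _ , c′ , _  , (inj₁ c′≡0 , c′≢0) , _ = c′≢0 c′≡0
... | w , _  , Ww , (inj₂ (y , ((4≤y , _) , _) , refl) , _) , eq rewrite unshift w 3 (shift y) eq =
  shift-misses-below y 3 (ℕP.≤-trans (s≤s (s≤s z≤n)) 4≤y) 4≤y Ww
C₀-minimal c (inj₂ (y , chosen@((_ , ¬Wy) , _) , refl)) (_ , complement) with complement (+ y)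
... | w , _  , Ww , (inj₁ refl , _) , eq = ¬Wy (subst W (trans (sym (ℤP.+-identityʳ w)) eq) Ww)
... | w , _  , Ww , (inj₂ (y′ , chosen′@((4≤y′ , _) , _) , refl) , c′≢c) , eq
    rewrite unshift w y (shift y′) eq with ℕP.<-cmp y′ y
...   | tri< y′<y _ _ = earlier-misses chosen chosen′ y′<y Ww
...   | tri≈ _ refl _ = c′≢c refl
...   | tri> _ _ y<y′ = shift-misses-below y′ y (ℕP.≤-trans (s≤s (s≤s z≤n)) 4≤y′) y<y′ Ww

minimalComplement : Σ SetZ λ C → IsMinimalComplement W C
minimalComplement = C₀ , ((+ 0 , inj₁ refl) , C₀-complement) , C₀-minimal

-- Part (2): a middle element of an asymptotic complement is redundant.

-- Outside the blocks k < D + D′, a point of W can be moved down by D or up by D′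
-- without leaving W: inside block k ≥ D + D′ one of the two moves stays in the block.
escape : ∀ (D D′ : ℕ) w → W w →
  W (w - + D) ⊎ W (w + + D′) ⊎ Σ ℕ λ i → i ℕ.≤ blockEnd (D ℕ.+ D′) × w ≡ + i
escape D D′ w (inj₁ w≤3) = inj₁ (inj₁ (ℤP.≤-trans (ℤP.i-j≤i w (+ D)) w≤3))
escape D D′ (+ x) (inj₂ (k , 1≤k , +≤+ start≤x , +≤+ x≤end)) with k ℕ.<? D ℕ.+ D′
... | yes k<K = inj₂ (inj₂ (x , ℕP.≤-trans x≤end (blockEnd-mono 1≤k (ℕP.<⇒≤ k<K)) , refl))
... | no k≮K with blockStart k ℕ.+ D ℕ.≤? x
...   | yes roomBelow = inj₁ (subst W (sym x-D≡x∸D) (inj₂ (k , 1≤k , +≤+ down≥start , +≤+ down≤end)))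
  where
  x-D≡x∸D : + x - + D ≡ + (x ℕ.∸ D)
  x-D≡x∸D = trans (ℤP.[+m]-[+n]≡m⊖n x D) (ℤP.≤-⊖ (ℕP.≤-trans (ℕP.m≤n+m D _) roomBelow))
  down≥start : blockStart k ℕ.≤ x ℕ.∸ D
  down≥start = ℕP.m+n≤o⇒m≤o∸n _ roomBelow
  down≤end : x ℕ.∸ D ℕ.≤ blockEnd k
  down≤end = ℕP.≤-trans (ℕP.m∸n≤m x D) x≤end
...   | no noRoom = inj₂ (inj₁ (inj₂ (k , 1≤k , +≤+ up≥start , +≤+ up≤end)))
  where
  up≥start : blockStart k ℕ.≤ x ℕ.+ D′
  up≥start = ℕP.≤-trans start≤x (ℕP.m≤m+n x D′)
  up≤end : x ℕ.+ D′ ℕ.≤ blockEnd k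
  up≤end = ℕP.<⇒≤ (ℕP.<-≤-trans (ℕP.+-monoˡ-< D′ (ℕP.≰⇒> noRoom))
             (ℕP.≤-trans (ℕP.≤-reflexive (ℕP.+-assoc (blockStart k) D D′))
               (ℕP.+-monoʳ-≤ (blockStart k) (ℕP.≮⇒≥ k≮K))))

finite-transfer : ∀ {P Q : SetZ} (R : List ℤ) →
  FiniteZ (λ n → ¬ P n) → (∀ n → P n → Q n ⊎ n ∈ R) → FiniteZ (λ n → ¬ Q n)
finite-transfer {Q = Q} R (xs , listsMissed) transfer = xs ++ R , listed
  where
  listed : ∀ n → ¬ Q n → n ∈ xs ++ R
  listed n ¬Qn with n ∈? xs ++ R
  ... | yes n∈ = n∈
  ... | no n∉ =
    contradiction (∈-++⁺ˡ (listsMissed n λ Pn → [ ¬Qn , (λ n∈R → n∉ (∈-++⁺ʳ xs n∈R)) ] (transfer n Pn))) n∉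

≤-offset : ∀ {i j} → i ≤ j → j ≡ i + + ∣ j - i ∣
≤-offset {i} {j} i≤j = trans (split i j) (cong (_+_ i) (sym (ℤP.0≤i⇒+∣i∣≡i (ℤP.i≤j⇒0≤j-i i≤j))))
  where
  split : ∀ i j → j ≡ i + (j - i)
  split = solve-∀

module MiddleElement (C : SetZ) {a b c : ℤ} (Ca : C a) (Cc : C c) (a<b : a < b) (b<c : b < c) where

  D D′ : ℕ
  D = ∣ c - b ∣
  D′ = ∣ b - a ∣

  nearRange : List ℤ
  nearRange = map (λ i → + i + b) (upTo (suc (blockEnd (D ℕ.+ D′))))

  rerouted : ∀ n → (W ⊕ C) n → (W ⊕ (C without b)) n ⊎ n ∈ nearRange
  rerouted n (w , x , Ww , Cx , w+x≡n) with x ℤP.≟ b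
  ... | no x≢b = inj₁ (w , x , Ww , (Cx , x≢b) , w+x≡n)
  ... | yes refl with escape D D′ w Ww
  ...   | inj₁ Wdown = inj₁ (w - + D , c , Wdown , (Cc , λ c≡b → ℤP.<⇒≢ b<c (sym c≡b)) , trans viaC w+x≡n)
    where
    cancelDown : ∀ w b d → (w - d) + (b + d) ≡ w + b
    cancelDown = solve-∀
    viaC : (w - + D) + c ≡ w + x
    viaC = trans (cong (_+_ (w - + D)) (≤-offset (ℤP.<⇒≤ b<c))) (cancelDown w x (+ D))
  ...   | inj₂ (inj₁ Wup) = inj₁ (w + + D′ , a , Wup , (Ca , ℤP.<⇒≢ a<b) , trans viaA w+x≡n)
    where
    cancelUp : ∀ w a d → (w + d) + a ≡ w + (a + d)
    cancelUp = solve-∀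
    viaA : (w + + D′) + a ≡ w + x
    viaA = trans (cancelUp w a (+ D′)) (cong (_+_ w) (sym (≤-offset (ℤP.<⇒≤ a<b))))
  ...   | inj₂ (inj₂ (i , i≤T , refl)) =
    inj₂ (subst (_∈ nearRange) w+x≡n (∈-map⁺ (λ i → + i + b) (∈-upTo⁺ (s≤s i≤T))))

dropMiddle : ∀ (C : SetZ) → IsAsymptoticComplement W C → ∀ (a b c : ℤ) → C a → C b → C c →
  a < b → b < c → IsAsymptoticComplement W (C without b)
dropMiddle C (_ , finite) a b c Ca _ Cc a<b b<c =
  (a , Ca , ℤP.<⇒≢ a<b) , finite-transfer nearRange finite rerouted
  where open MiddleElement C Ca Cc a<b b<c

-- Part (3): no minimal asymptotic complement.

Pair : ℤ → ℤ → SetZ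
Pair c c′ x = x ≡ c ⊎ x ≡ c′

translate-injective : ∀ {w X} c → w + c ≡ c + X → w ≡ X
translate-injective {w} c eq = ∙-cancelˡ c w _ (trans (ℤP.+-comm c w) eq)

i≤+∣i∣ : ∀ i → i ≤ + ∣ i ∣
i≤+∣i∣ (+ _)    = ℤP.≤-refl
i≤+∣i∣ -[1+ _ ] = -≤+

-- Beyond any bound B, both W + c and W + (c + d) miss a common point: take the point n
-- with n − c the last integer and n − (c + d) the (d+1)-st integer below a far block.
farMiss≤ : ∀ (B c : ℤ) (d : ℕ) → Σ ℤ λ n → B < n × ¬ (W ⊕ Pair c (c + + d)) n
farMiss≤ B c d = c′ + + x , B<n , missed
  where
  c′ : ℤ
  c′ = c + + d
  R m S x : ℕ
  R = ∣ B - c′ ∣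
  m = d ℕ.+ R
  S = blockStart (2 ℕ.+ m)
  x = S ℕ.∸ suc d
  2+m<S : 2 ℕ.+ m ℕ.< S
  2+m<S = k<blockStart (2 ℕ.+ m)
  1+d≤1+m : suc d ℕ.≤ suc m
  1+d≤1+m = s≤s (ℕP.m≤m+n d R)
  x+1+d≡S : x ℕ.+ suc d ≡ S
  x+1+d≡S = ℕP.m∸n+n≡m (ℕP.≤-trans (ℕP.m≤n⇒m≤1+n 1+d≤1+m) (ℕP.<⇒≤ 2+m<S))
  R<x : R ℕ.< x
  R<x = ℕP.m+n≤o⇒m≤o∸n (suc R) (ℕP.≤-trans (ℕP.≤-reflexive (regroup d R)) (ℕP.<⇒≤ 2+m<S))
    where
    regroup : ∀ d R → suc R ℕ.+ suc d ≡ 2 ℕ.+ (d ℕ.+ R)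
    regroup = ℕSolver.solve-∀
  B<n : B < c′ + + x
  B<n = ℤP.≤-<-trans (ℤP.≤-trans (ℤP.≤-reflexive (split c′ B)) (ℤP.+-monoʳ-≤ c′ (i≤+∣i∣ (B - c′))))
                     (ℤP.+-monoʳ-< c′ (+<+ R<x))
    where
    split : ∀ c′ B → B ≡ c′ + (B - c′)
    split = solve-∀
  wide : suc d ℕ.≤ 2 ℕ.^ (suc m ℕ.+ 1)
  wide = ℕP.≤-trans 1+d≤1+m (ℕP.≤-trans (ℕP.m≤m+n (suc m) 1) (ℕP.<⇒≤ (n<2^n (suc m ℕ.+ 1))))
  missed : ¬ (W ⊕ Pair c c′) (c′ + + x)
  missed (w , _ , Ww , inj₁ refl , eq) =
    ¬W-belowBlock m (d ℕ.+ x) 1 (trans (regroup d x) x+1+d≡S) (s≤s z≤n) (ℕP.≤-trans (s≤s z≤n) wide)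
      (subst W (translate-injective c (trans eq (ℤP.+-assoc c (+ d) (+ x)))) Ww)
    where
    regroup : ∀ d x → d ℕ.+ x ℕ.+ 1 ≡ x ℕ.+ suc d
    regroup = ℕSolver.solve-∀
  missed (w , _ , Ww , inj₂ refl , eq) =
    ¬W-belowBlock m x (suc d) x+1+d≡S (s≤s z≤n) wide (subst W (translate-injective c′ eq) Ww)

farMiss : ∀ (B c c′ : ℤ) → Σ ℤ λ n → B < n × ¬ (W ⊕ Pair c c′) n
farMiss B c c′ with ℤP.≤-total c c′
... | inj₁ c≤c′ rewrite ≤-offset c≤c′ = farMiss≤ B c _
... | inj₂ c′≤c with farMiss≤ B c′ ∣ c - c′ ∣
...   | n , B<n , missed rewrite sym (≤-offset c′≤c) =
  n , B<n , λ (w , y , Ww , y∈ , eq) → missed (w , y , Ww , swap y∈ , eq)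
  where
  swap : ∀ {y} → Pair c c′ y → Pair c′ c y
  swap (inj₁ y≡c)  = inj₂ y≡c
  swap (inj₂ y≡c′) = inj₁ y≡c′

notWithinTwo : ∀ {C} → IsAsymptoticComplement W C → ∀ c c′ → ¬ (∀ x → C x → Pair c c′ x)
notWithinTwo (_ , xs , listsMissed) c c′ C⊆pair with farMiss (max (+ 0) xs) c c′
... | n , bound<n , missed =
  ℤP.<⇒≱ bound<n (All.lookup (xs≤max (+ 0) xs) (listsMissed n
    λ (w , y , Ww , Cy , eq) → missed (w , y , Ww , C⊆pair y Cy , eq)))

sortThree : ∀ {P : ℤ → Set} {x y z} → P x → P y → P z → x ≢ y → x ≢ z → y ≢ z →
  Σ ℤ λ a → Σ ℤ λ b → Σ ℤ λ c → P a × P b × P c × a < b × b < c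
sortThree {x = x} {y} {z} px py pz x≢y x≢z y≢z with ℤP.<-cmp x y | ℤP.<-cmp y z | ℤP.<-cmp x z
... | tri≈ _ x≡y _ | _            | _            = contradiction x≡y x≢y
... | _            | tri≈ _ y≡z _ | _            = contradiction y≡z y≢z
... | _            | _            | tri≈ _ x≡z _ = contradiction x≡z x≢z
... | tri< x<y _ _ | tri< y<z _ _ | _            = x , y , z , px , py , pz , x<y , y<z
... | tri< x<y _ _ | tri> _ _ z<y | tri< x<z _ _ = x , z , y , px , pz , py , x<z , z<y
... | tri< x<y _ _ | tri> _ _ z<y | tri> _ _ z<x = z , x , y , pz , px , py , z<x , x<y
... | tri> _ _ y<x | tri< y<z _ _ | tri< x<z _ _ = y , x , z , py , px , pz , y<x , x<z
... | tri> _ _ y<x | tri< y<z _ _ | tri> _ _ z<x = y , z , x , py , pz , px , y<z , z<x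
... | tri> _ _ y<x | tri> _ _ z<y | _            = z , y , x , pz , py , px , z<y , y<x

noThreePoints : ∀ {C x y z} → IsMinimalAsymptoticComplement W C →
  C x → C y → C z → x ≢ y → x ≢ z → y ≢ z → ⊥
noThreePoints (asym , minimal) Cx Cy Cz x≢y x≢z y≢z with sortThree Cx Cy Cz x≢y x≢z y≢z
... | a , b , c , Ca , Cb , Cc , a<b , b<c = minimal b Cb (dropMiddle _ asym a b c Ca Cb Cc a<b b<c)

-- Such a C would have to be a single point c₀: a second point x would confine C to {c₀, x}.
noMinimalAsymptotic : ¬ (Σ SetZ λ C → IsMinimalAsymptoticComplement W C)
noMinimalAsymptotic (C , minAsym@(asym@((c₀ , Cc₀) , _) , _)) =
  notWithinTwo asym c₀ c₀ (λ x Cx → inj₁ (onlyC₀ x Cx))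
  where
  onlyC₀ : ∀ x → C x → x ≡ c₀
  onlyC₀ x Cx = decidable-stable (x ℤP.≟ c₀) λ x≢c₀ → notWithinTwo asym c₀ x (withinPair x≢c₀)
    where
    withinPair : x ≢ c₀ → ∀ y → C y → Pair c₀ x y
    withinPair x≢c₀ y Cy with y ℤP.≟ c₀ | y ℤP.≟ x
    ... | yes y≡c₀ | _       = inj₁ y≡c₀
    ... | no _     | yes y≡x = inj₂ y≡x
    ... | no y≢c₀  | no y≢x  =
      ⊥-elim (noThreePoints minAsym Cc₀ Cx Cy (λ e → x≢c₀ (sym e)) (λ e → y≢c₀ (sym e)) (λ e → y≢x (sym e)))

lemma4p3 : (Σ SetZ λ C → IsMinimalComplement W C)
    × (∀ (C : SetZ) → IsAsymptoticComplement W C → ∀ (a b c : ℤ) → C a → C b → C c → a < b → b < c → IsAsymptoticComplement W (C without b))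
    × ¬ (Σ SetZ λ C → IsMinimalAsymptoticComplement W C)
lemma4p3 = minimalComplement , dropMiddle , noMinimalAsymptotic
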